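{- For integers $r,s\geq 2$, \[ \log_2\left(\left\lfloor \frac{\sqrt{1+8(r-1)(s-1)}-1}{2}\right\rfloor+r+s\right)\leq\operatorname{BR}^2(\vee_r,\wedge_s)\leq \left\lceil\log_{3/2}(r+s-1)\right\rceil. \]
   Context: The $r$-cup $\vee_r$ is the 2-uniform pograph on the poset $\{x,y_1,\dots,y_r\}$ with $x\le y_i$ for all $i$ and edges $xy_i$; the $s$-cap $\wedge_s$ is the pograph on $\{y,x_1,\dots,x_s\}$ with $x_i\le y$ and edges $x_iy$. Given a coloring of the comparable pairs of a poset $Q$, a copy of $H$ in color $i$ is an injection $f:V(H)\to Q$ with $f(x)\le f(y)$ whenever $x\le y$ such that every edge of $H$ is mapped to a pair of color $i$. $\operatorname{BR}^2(G_1,G_2)$ is the least $N$ such that every 2-coloring of the comparable pairs of the Boolean lattice $B_N$ (subsets of $[N]$) contains a copy of $G_1$ in color 1 or a copy of $G_2$ in color 2. -}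

module Defs where

open import Data.Nat using (ℕ; suc; _+_; _*_; _∸_; _^_; _≤_; _<_)
open import Data.Nat.DivMod using (_/_)
open import Data.Fin using (Fin; zero; suc)
open import Data.Fin.Subset using (Subset; _⊆_)
open import Data.Product using (Σ; _×_; ∃-syntax)
open import Data.Sum using (_⊎_)
open import Function.Definitions using (Injective)
open import Relation.Binary.PropositionalEquality using (_≡_)

-- A (2-uniform) pograph on the vertex set Fin n: a partial order _≼_
-- (given as a relation) together with an edge relation; an edge u v is
-- meant with u ≼ v, u ≢ v.
record Pograph : Set₁ where
  field
    size : ℕ
    _≼_  : Fin size → Fin size → Set
    Edge : Fin size → Fin size → Set
open Pograph public

-- r-cup: vertex zero is x, vertex (suc i) is y_{i+1}; x ≤ y_i; edges x y_i.
data CupLe {r : ℕ} : Fin (suc r) → Fin (suc r) → Set where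
  cup-refl : ∀ {u} → CupLe u u
  cup-xy   : ∀ {i} → CupLe zero (suc i)

data CupEdge {r : ℕ} : Fin (suc r) → Fin (suc r) → Set where
  cup-edge : ∀ {i} → CupEdge zero (suc i)

Cup : ℕ → Pograph
Cup r = record { size = suc r ; _≼_ = CupLe {r} ; Edge = CupEdge {r} }

-- s-cap: vertex zero is y, vertex (suc i) is x_{i+1}; x_i ≤ y; edges x_i y.
data CapLe {s : ℕ} : Fin (suc s) → Fin (suc s) → Set where
  cap-refl : ∀ {u} → CapLe u u
  cap-xy   : ∀ {i} → CapLe (suc i) zero

data CapEdge {s : ℕ} : Fin (suc s) → Fin (suc s) → Set where
  cap-edge : ∀ {i} → CapEdge (suc i) zero

Cap : ℕ → Pograph
Cap s = record { size = suc s ; _≼_ = CapLe {s} ; Edge = CapEdge {s} }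

data Colour : Set where
  colour₁ colour₂ : Colour

-- A comparable pair {A , B} with A ⊂ B receives the colour c A B; values of
-- c on non-comparable (or equal) arguments are irrelevant, since only
-- c A B with A ⊆ B, A ≢ B is ever consulted below.
Colouring : ℕ → Set
Colouring N = Subset N → Subset N → Colour

Copy : (N : ℕ) → Colouring N → (H : Pograph) → Colour → Set
Copy N c H i =
  Σ (Fin (size H) → Subset N) λ f →
    Injective _≡_ _≡_ f
    × (∀ u v → _≼_ H u v → f u ⊆ f v)
    × (∀ u v → Edge H u v → c (f u) (f v) ≡ i)

-- B_N → (G₁ , G₂): every 2-colouring of B_N has a copy of G₁ in colour 1
-- or a copy of G₂ in colour 2.  BR²(G₁,G₂) is the least such N.
Arrows : ℕ → Pograph → Pograph → Set
Arrows N G₁ G₂ = ∀ (c : Colouring N) → Copy N c G₁ colour₁ ⊎ Copy N c G₂ colour₂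

IsFloorSqrt : ℕ → ℕ → Set
IsFloorSqrt n q = q * q ≤ n × n < suc q * suc q

-- k is ⌈log_{3/2} m⌉, i.e. the least k with m ≤ (3/2)^k, i.e. m·2^k ≤ 3^k.
IsCeilLog32 : ℕ → ℕ → Set
IsCeilLog32 m k = m * 2 ^ k ≤ 3 ^ k × (∀ j → m * 2 ^ j ≤ 3 ^ j → k ≤ j)

-- Upper bound: double counting.  If a 2-colouring of B_N has no colour-1 r-cup and no
-- colour-2 s-cap, every set has fewer than r colour-1 strict supersets and fewer than s
-- colour-2 strict subsets, so the 3^N − 2^N strictly comparable pairs number at most
-- (r − 1 + s − 1) 2^N.  Hence 3^N ≤ (r + s − 1) 2^N, and equality is impossible since 3^N
-- is odd.
--
-- Lower bound: colour a pair A ⊂ B by its top alone, with colour 2 iff B misses at least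
-- k points.  For k = 1 all colour-1 tops equal [N], so there is no colour-1 cup with two
-- tops; for k = 2 colour-1 tops miss at most one point, so a colour-1 cup has at most N + 1
-- tops; a colour-2 cap lies inside a set of size at most N − k, so it has at most 2^(N−k)
-- vertices.  Complementing every set and swapping the colours exchanges cups and caps.
-- Elementary arithmetic (checked exhaustively for N < 7) shows that one of these four
-- colourings works whenever 2^N < t + r + s, where t = ⌊(√(1 + 8(r−1)(s−1)) − 1)/2⌋ is the
-- largest t with t(t + 1) ≤ 2(r − 1)(s − 1).

module Submission where

open import Defs
open import Algebra.Properties.CommutativeSemigroup as CommSemigroup using ()
open import Data.Bool.Base using (not; if_then_else_)
open import Data.Bool.Properties using (not-involutive)
open import Data.Empty using (⊥)
open import Data.Fin.Base using (Fin; zero; suc; toℕ; fromℕ<)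
import Data.Fin.Base as Fin
open import Data.Fin.Properties using (injective⇒≤; all?; toℕ-fromℕ<) renaming (suc-injective to Fin-suc-injective)
open import Data.Fin.Subset using (Subset; _⊆_; _⊂_; ∁; ⊤; ∣_∣; outside; inside)
open import Data.Fin.Subset.Properties using (_⊆?_; _⊂?_; drop-∷-⊆; ⊆-refl; ⊂-irref; p⊆q⇒∁p⊇∁q; ∣p∣≤n; ∣∁p∣≡n∸∣p∣; ∣p∣≡n⇒p≡⊤; ∣⊤∣≡n)
open import Data.List.Base using (List; []; _∷_; [_]; _++_; map; length; lookup)
open import Data.List.Properties using (length-map; length-++)
open import Data.List.Membership.Propositional using (_∈_)
open import Data.List.Membership.Propositional.Properties using (∈-map⁺; ∈-map⁻; ∈-++⁺ˡ; ∈-++⁺ʳ)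
open import Data.List.Relation.Unary.All as All using (All; []; _∷_)
open import Data.List.Relation.Unary.All.Properties using (¬Any⇒All¬)
open import Data.List.Relation.Unary.Any as Any using (here; there)
open import Data.List.Relation.Unary.Any.Properties using (lookup-index)
open import Data.List.Relation.Unary.AllPairs using ([]; _∷_)
open import Data.List.Relation.Unary.Unique.Propositional using (Unique)
import Data.List.Relation.Unary.Unique.Propositional.Properties as Unique
open import Data.Nat.Base using (ℕ; zero; suc; _+_; _*_; _∸_; _^_; _≤_; _<_; z≤n; s≤s; z<s)
open import Data.Nat.DivMod using (_/_; m/n*n≤m)
open import Data.Nat.Properties
open import Data.Nat.Tactic.RingSolver using (solve-∀)
open import Data.Product using (Σ; _×_; _,_; proj₁; proj₂; ∃-syntax)
open import Data.Sum using (_⊎_; inj₁; inj₂; [_,_]′)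
open import Data.Unit using (tt)
open import Data.Vec.Base using (_∷_; [])
import Data.Vec.Base as Vec
open import Data.Vec.Functional using () renaming (_∷_ to _◂_)
open import Data.Vec.Properties using (∷-injectiveʳ; map-∘; map-cong; map-id)
open import Function.Base using (_∘_)
open import Function.Definitions using (Injective)
open import Level using (0ℓ)
open import Relation.Binary.Definitions using (DecidableEquality)
open import Relation.Binary.PropositionalEquality using (_≡_; _≢_; ≢-sym; refl; sym; trans; cong; cong₂; subst; subst₂; module ≡-Reasoning)
open import Relation.Nullary using (¬_; Dec; yes; no; does; ¬?; contradiction)
open import Relation.Nullary.Decidable using (_⊎-dec_; _×-dec_; _→-dec_; map′; toWitness)
open import Relation.Unary using (Pred; Decidable)
open CommSemigroup +-commutativeSemigroup using (interchange; x∙yz≈y∙xz; xy∙z≈xz∙y)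


private variable X Y : Set

∑ : List X → (X → ℕ) → ℕ
∑ []       f = 0
∑ (x ∷ xs) f = f x + ∑ xs f

syntax ∑ xs (λ x → e) = ∑[ x ∈ xs ] e

∑-++ : ∀ (xs ys : List X) f → ∑ (xs ++ ys) f ≡ ∑ xs f + ∑ ys f
∑-++ []       ys f = refl
∑-++ (x ∷ xs) ys f = trans (cong (f x +_) (∑-++ xs ys f)) (sym (+-assoc (f x) _ _))

∑-map : ∀ (g : X → Y) (xs : List X) f → ∑ (map g xs) f ≡ ∑ xs (f ∘ g)
∑-map g []       f = refl
∑-map g (x ∷ xs) f = cong (f (g x) +_) (∑-map g xs f)

∑-cong : ∀ (xs : List X) {f g : X → ℕ} → (∀ x → f x ≡ g x) → ∑ xs f ≡ ∑ xs g
∑-cong []       f≗g = refl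
∑-cong (x ∷ xs) f≗g = cong₂ _+_ (f≗g x) (∑-cong xs f≗g)

∑-zero : ∀ (xs : List X) → ∑[ x ∈ xs ] 0 ≡ 0
∑-zero []       = refl
∑-zero (x ∷ xs) = ∑-zero xs

∑-+ : ∀ (xs : List X) f g → ∑[ x ∈ xs ] (f x + g x) ≡ ∑ xs f + ∑ xs g
∑-+ []       f g = refl
∑-+ (x ∷ xs) f g = trans (cong (f x + g x +_) (∑-+ xs f g)) (interchange (f x) (g x) (∑ xs f) (∑ xs g))

∑-comm : ∀ (xs : List X) (ys : List Y) (f : X → Y → ℕ) →
         ∑[ x ∈ xs ] ∑[ y ∈ ys ] f x y ≡ ∑[ y ∈ ys ] ∑[ x ∈ xs ] f x y
∑-comm []       ys f = sym (∑-zero ys)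
∑-comm (x ∷ xs) ys f = begin
  ∑ ys (f x) + ∑[ x′ ∈ xs ] ∑ ys (f x′)         ≡⟨ cong (∑ ys (f x) +_) (∑-comm xs ys f) ⟩
  ∑ ys (f x) + ∑[ y ∈ ys ] ∑[ x′ ∈ xs ] f x′ y  ≡⟨ ∑-+ ys (f x) (λ y → ∑[ x′ ∈ xs ] f x′ y) ⟨
  ∑[ y ∈ ys ] (f x y + ∑[ x′ ∈ xs ] f x′ y)     ∎
  where open ≡-Reasoning

∑-suc : ∀ (xs : List X) f → ∑[ x ∈ xs ] suc (f x) ≡ length xs + ∑ xs f
∑-suc []       f = refl
∑-suc (x ∷ xs) f = cong suc (trans (cong (f x +_) (∑-suc xs f)) (x∙yz≈y∙xz (f x) (length xs) (∑ xs f)))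

∑-≤ : ∀ {xs : List X} (f : X → ℕ) {k} → All (λ x → f x ≤ k) xs → ∑ xs f ≤ length xs * k
∑-≤ f []           = z≤n
∑-≤ f (fx≤k ∷ f≤k) = +-mono-≤ fx≤k (∑-≤ f f≤k)

subsetsOf : ∀ {n} → Subset n → List (Subset n)
subsetsOf []            = [ [] ]
subsetsOf (outside ∷ p) = map (outside ∷_) (subsetsOf p)
subsetsOf (inside ∷ p)  = map (outside ∷_) (subsetsOf p) ++ map (inside ∷_) (subsetsOf p)

subsets : ∀ n → List (Subset n)
subsets n = subsetsOf ⊤

length-subsetsOf : ∀ {n} (p : Subset n) → length (subsetsOf p) ≡ 2 ^ ∣ p ∣
length-subsetsOf []            = refl
length-subsetsOf (outside ∷ p) = trans (length-map (outside ∷_) (subsetsOf p)) (length-subsetsOf p)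
length-subsetsOf (inside ∷ p)  = begin
  length (map (outside ∷_) (subsetsOf p) ++ map (inside ∷_) (subsetsOf p))
    ≡⟨ length-++ (map (outside ∷_) (subsetsOf p)) ⟩
  length (map (outside ∷_) (subsetsOf p)) + length (map (inside ∷_) (subsetsOf p))
    ≡⟨ cong₂ _+_ (length-map (outside ∷_) (subsetsOf p)) (length-map (inside ∷_) (subsetsOf p)) ⟩
  length (subsetsOf p) + length (subsetsOf p)
    ≡⟨ cong (λ m → m + m) (length-subsetsOf p) ⟩
  2 ^ ∣ p ∣ + 2 ^ ∣ p ∣
    ≡⟨ cong (2 ^ ∣ p ∣ +_) (+-identityʳ (2 ^ ∣ p ∣)) ⟨
  2 * 2 ^ ∣ p ∣ ∎
  where open ≡-Reasoning

length-subsets : ∀ n → length (subsets n) ≡ 2 ^ n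
length-subsets n = trans (length-subsetsOf (⊤ {n})) (cong (2 ^_) (∣⊤∣≡n n))

∈-subsetsOf : ∀ {n} {p q : Subset n} → q ⊆ p → q ∈ subsetsOf p
∈-subsetsOf {p = []}          {[]}          _   = here refl
∈-subsetsOf {p = outside ∷ p} {outside ∷ q} q⊆p = ∈-map⁺ (outside ∷_) (∈-subsetsOf (drop-∷-⊆ q⊆p))
∈-subsetsOf {p = outside ∷ p} {inside ∷ q}  q⊆p with q⊆p Vec.here
... | ()
∈-subsetsOf {p = inside ∷ p}  {outside ∷ q} q⊆p =
  ∈-++⁺ˡ (∈-map⁺ (outside ∷_) (∈-subsetsOf (drop-∷-⊆ q⊆p)))
∈-subsetsOf {p = inside ∷ p}  {inside ∷ q}  q⊆p =
  ∈-++⁺ʳ (map (outside ∷_) (subsetsOf p)) (∈-map⁺ (inside ∷_) (∈-subsetsOf (drop-∷-⊆ q⊆p)))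

subsetsOf-unique : ∀ {n} (p : Subset n) → Unique (subsetsOf p)
subsetsOf-unique []            = [] ∷ []
subsetsOf-unique (outside ∷ p) = Unique.map⁺ ∷-injectiveʳ (subsetsOf-unique p)
subsetsOf-unique (inside ∷ p)  = Unique.++⁺
  (Unique.map⁺ ∷-injectiveʳ (subsetsOf-unique p))
  (Unique.map⁺ ∷-injectiveʳ (subsetsOf-unique p))
  λ (q∈₀ , q∈₁) → outside≢inside (∈-map⁻ (outside ∷_) q∈₀) (∈-map⁻ (inside ∷_) q∈₁)
  where
  outside≢inside : ∀ {q} → ∃[ x ] (x ∈ subsetsOf p × q ≡ outside ∷ x) →
                   ∃[ y ] (y ∈ subsetsOf p × q ≡ inside ∷ y) → ⊥
  outside≢inside (_ , _ , refl) (_ , _ , ())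

∑-subsets-suc : ∀ n (f : Subset (suc n) → ℕ) →
  ∑ (subsets (suc n)) f ≡ ∑[ A ∈ subsets n ] f (outside ∷ A) + ∑[ A ∈ subsets n ] f (inside ∷ A)
∑-subsets-suc n f = begin
  ∑ (map (outside ∷_) (subsets n) ++ map (inside ∷_) (subsets n)) f
    ≡⟨ ∑-++ (map (outside ∷_) (subsets n)) _ f ⟩
  ∑ (map (outside ∷_) (subsets n)) f + ∑ (map (inside ∷_) (subsets n)) f
    ≡⟨ cong₂ _+_ (∑-map (outside ∷_) (subsets n) f) (∑-map (inside ∷_) (subsets n) f) ⟩
  ∑[ A ∈ subsets n ] f (outside ∷ A) + ∑[ A ∈ subsets n ] f (inside ∷ A) ∎
  where open ≡-Reasoning

∑² : ∀ {n} → (Subset n → Subset n → ℕ) → ℕ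
∑² {n} f = ∑[ A ∈ subsets n ] ∑[ B ∈ subsets n ] f A B

∑²-cong : ∀ {n} {f g : Subset n → Subset n → ℕ} → (∀ A B → f A B ≡ g A B) → ∑² f ≡ ∑² g
∑²-cong {n} f≗g = ∑-cong (subsets n) (λ A → ∑-cong (subsets n) (f≗g A))

∑²-zero : ∀ n → ∑² {n} (λ _ _ → 0) ≡ 0
∑²-zero n = trans (∑-cong (subsets n) (λ _ → ∑-zero (subsets n))) (∑-zero (subsets n))

∑²-suc : ∀ {n} (f : Subset (suc n) → Subset (suc n) → ℕ) →
  ∑² f ≡ (∑² (λ A B → f (outside ∷ A) (outside ∷ B)) + ∑² (λ A B → f (outside ∷ A) (inside ∷ B)))
       + (∑² (λ A B → f (inside ∷ A) (outside ∷ B)) + ∑² (λ A B → f (inside ∷ A) (inside ∷ B)))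
∑²-suc {n} f = trans (∑-subsets-suc n (λ A → ∑ (subsets (suc n)) (f A)))
  (cong₂ _+_ (split outside) (split inside))
  where
  split : ∀ x → ∑[ A ∈ subsets n ] ∑ (subsets (suc n)) (f (x ∷ A))
              ≡ ∑² (λ A B → f (x ∷ A) (outside ∷ B)) + ∑² (λ A B → f (x ∷ A) (inside ∷ B))
  split x = trans (∑-cong (subsets n) (λ A → ∑-subsets-suc n (f (x ∷ A)))) (∑-+ (subsets n) _ _)

𝟙 : ∀ {P : Set} → Dec P → ℕ
𝟙 P? = if does P? then 1 else 0

∑²-⊆ : ∀ n → ∑² {n} (λ A B → 𝟙 (A ⊆? B)) ≡ 3 ^ n
∑²-⊆ zero    = refl
∑²-⊆ (suc n) = begin
  ∑² {suc n} (λ A B → 𝟙 (A ⊆? B))   ≡⟨ ∑²-suc {n} (λ A B → 𝟙 (A ⊆? B)) ⟩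
  (F + F) + (∑² {n} (λ _ _ → 0) + F) ≡⟨ cong (λ z → (F + F) + (z + F)) (∑²-zero n) ⟩
  (F + F) + F                        ≡⟨ cong (λ z → (z + z) + z) (∑²-⊆ n) ⟩
  (3 ^ n + 3 ^ n) + 3 ^ n            ≡⟨ thrice (3 ^ n) ⟩
  3 ^ suc n                          ∎
  where
  open ≡-Reasoning
  F = ∑² {n} (λ A B → 𝟙 (A ⊆? B))
  thrice : ∀ x → (x + x) + x ≡ 3 * x
  thrice = solve-∀

-- In the quadrant (outside , inside) strictness is automatic, so it counts the pairs A ⊆ B.
∑²-⊂ : ∀ n → ∑² {n} (λ A B → 𝟙 (A ⊂? B)) + 2 ^ n ≡ 3 ^ n
∑²-⊂ zero    = refl
∑²-⊂ (suc n) = begin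
  ∑² {suc n} (λ A B → 𝟙 (A ⊂? B)) + 2 ^ suc n
    ≡⟨ cong (_+ 2 ^ suc n) (∑²-suc {n} (λ A B → 𝟙 (A ⊂? B))) ⟩
  (G + F) + (∑² {n} (λ _ _ → 0) + G) + 2 ^ suc n
    ≡⟨ cong (λ z → (G + F) + (z + G) + 2 ^ suc n) (∑²-zero n) ⟩
  (G + F) + G + 2 * 2 ^ n
    ≡⟨ regroup G F (2 ^ n) ⟩
  2 * (G + 2 ^ n) + F
    ≡⟨ cong₂ (λ u v → 2 * u + v) (∑²-⊂ n) (∑²-⊆ n) ⟩
  2 * 3 ^ n + 3 ^ n
    ≡⟨ regroup′ (3 ^ n) ⟩
  3 ^ suc n ∎
  where
  open ≡-Reasoning
  F = ∑² {n} (λ A B → 𝟙 (A ⊆? B))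
  G = ∑² {n} (λ A B → 𝟙 (A ⊂? B))
  regroup : ∀ g f p → (g + f) + g + 2 * p ≡ 2 * (g + p) + f
  regroup = solve-∀
  regroup′ : ∀ x → 2 * x + x ≡ 3 * x
  regroup′ = solve-∀

_◂-injective_ : ∀ {A : Set} {r} {x : A} {g : Fin r → A} →
  (∀ j → x ≢ g j) → Injective _≡_ _≡_ g → Injective _≡_ _≡_ (x ◂ g)
(x∉g ◂-injective g-inj) {zero}  {zero}  _ = refl
(x∉g ◂-injective g-inj) {zero}  {suc j} e = contradiction e (x∉g j)
(x∉g ◂-injective g-inj) {suc i} {zero}  e = contradiction (sym e) (x∉g i)
(x∉g ◂-injective g-inj) {suc i} {suc j} e = cong suc (g-inj e)

module _ {A : Set} {P : Pred A 0ℓ} (P? : Decidable P) where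

  count : List A → ℕ
  count xs = ∑[ x ∈ xs ] 𝟙 (P? x)

  distinct-witnesses : ∀ {xs} → Unique xs → ∀ r → r ≤ count xs →
    Σ (Fin r → A) λ g → Injective _≡_ _≡_ g × (∀ i → g i ∈ xs × P (g i))
  distinct-witnesses _ zero _ = (λ ()) , (λ {i} → λ { }) , (λ ())
  distinct-witnesses {x ∷ xs} (x∉xs ∷ xs!) (suc r) r<count with P? x
  ... | no _ with distinct-witnesses xs! (suc r) r<count
  ...   | g , g-inj , g-ok = g , g-inj , λ i → there (proj₁ (g-ok i)) , proj₂ (g-ok i)
  distinct-witnesses {x ∷ xs} (x∉xs ∷ xs!) (suc r) (s≤s r≤count) | yes Px
    with distinct-witnesses xs! r r≤count
  ... | g , g-inj , g-ok = x ◂ g , x∉g ◂-injective g-inj , ok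
    where
    x∉g : ∀ i → x ≢ g i
    x∉g i = All.lookup x∉xs (proj₁ (g-ok i))
    ok : ∀ i → (x ◂ g) i ∈ x ∷ xs × P ((x ◂ g) i)
    ok zero    = here refl , Px
    ok (suc i) = there (proj₁ (g-ok i)) , proj₂ (g-ok i)

cup-copy : ∀ {N} {c : Colouring N} {i r} (A : Subset N) (g : Fin r → Subset N) →
  Injective _≡_ _≡_ g → (∀ j → A ⊆ g j × A ≢ g j × c A (g j) ≡ i) → Copy N c (Cup r) i
cup-copy {c = c} {i} A g g-inj g-ok = A ◂ g , (proj₁ ∘ proj₂ ∘ g-ok) ◂-injective g-inj , mono , edge
  where
  mono : ∀ u v → CupLe u v → (A ◂ g) u ⊆ (A ◂ g) v
  mono _ _ cup-refl      = ⊆-refl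
  mono _ _ (cup-xy {j})  = proj₁ (g-ok j)
  edge : ∀ u v → CupEdge u v → c ((A ◂ g) u) ((A ◂ g) v) ≡ i
  edge _ _ (cup-edge {j}) = proj₂ (proj₂ (g-ok j))

cap-copy : ∀ {N} {c : Colouring N} {i s} (B : Subset N) (g : Fin s → Subset N) →
  Injective _≡_ _≡_ g → (∀ j → g j ⊆ B × g j ≢ B × c (g j) B ≡ i) → Copy N c (Cap s) i
cap-copy {c = c} {i} B g g-inj g-ok =
  B ◂ g , (λ j → ≢-sym (proj₁ (proj₂ (g-ok j)))) ◂-injective g-inj , mono , edge
  where
  mono : ∀ u v → CapLe u v → (B ◂ g) u ⊆ (B ◂ g) v
  mono _ _ cap-refl      = ⊆-refl
  mono _ _ (cap-xy {j})  = proj₁ (g-ok j)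
  edge : ∀ u v → CapEdge u v → c ((B ◂ g) u) ((B ◂ g) v) ≡ i
  edge _ _ (cap-edge {j}) = proj₂ (proj₂ (g-ok j))

_≟ᶜ_ : DecidableEquality Colour
colour₁ ≟ᶜ colour₁ = yes refl
colour₁ ≟ᶜ colour₂ = no λ ()
colour₂ ≟ᶜ colour₁ = no λ ()
colour₂ ≟ᶜ colour₂ = yes refl

𝟙-split-by-colour : ∀ {P : Set} (P? : Dec P) x →
  𝟙 P? ≡ 𝟙 (P? ×-dec x ≟ᶜ colour₁) + 𝟙 (P? ×-dec x ≟ᶜ colour₂)
𝟙-split-by-colour (yes _) colour₁ = refl
𝟙-split-by-colour (yes _) colour₂ = refl
𝟙-split-by-colour (no _)  _       = refl

module ColourCounts {N : ℕ} (c : Colouring N) where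

  _⊂[_]?_ : ∀ A i B → Dec (A ⊂ B × c A B ≡ i)
  A ⊂[ i ]? B = A ⊂? B ×-dec c A B ≟ᶜ i

  up₁ : Subset N → ℕ
  up₁ A = count (A ⊂[ colour₁ ]?_) (subsets N)

  down₂ : Subset N → ℕ
  down₂ B = count (_⊂[ colour₂ ]? B) (subsets N)

  ∑up₁+∑down₂ : ∑ (subsets N) up₁ + ∑ (subsets N) down₂ + 2 ^ N ≡ 3 ^ N
  ∑up₁+∑down₂ = trans (cong (_+ 2 ^ N) (sym strict-pairs-by-colour)) (∑²-⊂ N)
    where
    open ≡-Reasoning
    Up = λ A B → 𝟙 (A ⊂[ colour₁ ]? B)
    Down = λ A B → 𝟙 (A ⊂[ colour₂ ]? B)
    strict-pairs-by-colour : ∑² {N} (λ A B → 𝟙 (A ⊂? B)) ≡ ∑ (subsets N) up₁ + ∑ (subsets N) down₂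
    strict-pairs-by-colour = begin
      ∑² {N} (λ A B → 𝟙 (A ⊂? B))
        ≡⟨ ∑²-cong (λ A B → 𝟙-split-by-colour (A ⊂? B) (c A B)) ⟩
      ∑[ A ∈ subsets N ] ∑[ B ∈ subsets N ] (Up A B + Down A B)
        ≡⟨ ∑-cong (subsets N) (λ A → ∑-+ (subsets N) (Up A) (Down A)) ⟩
      ∑[ A ∈ subsets N ] (up₁ A + ∑[ B ∈ subsets N ] Down A B)
        ≡⟨ ∑-+ (subsets N) up₁ (λ A → ∑ (subsets N) (Down A)) ⟩
      ∑ (subsets N) up₁ + ∑[ A ∈ subsets N ] ∑[ B ∈ subsets N ] Down A B
        ≡⟨ cong (∑ (subsets N) up₁ +_) (∑-comm (subsets N) (subsets N) Down) ⟩
      ∑ (subsets N) up₁ + ∑ (subsets N) down₂ ∎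

  cup-if-r≤up₁ : ∀ {r} A → r ≤ up₁ A → Copy N c (Cup r) colour₁
  cup-if-r≤up₁ {r} A r≤up₁ with distinct-witnesses (A ⊂[ colour₁ ]?_) (subsetsOf-unique ⊤) r r≤up₁
  ... | g , g-inj , g-ok = cup-copy {c = c} A g g-inj λ j →
    let (A⊂g , colour) = proj₂ (g-ok j) in proj₁ A⊂g , (λ A≡g → ⊂-irref A≡g A⊂g) , colour

  cap-if-s≤down₂ : ∀ {s} B → s ≤ down₂ B → Copy N c (Cap s) colour₂
  cap-if-s≤down₂ {s} B s≤down₂ with distinct-witnesses (_⊂[ colour₂ ]? B) (subsetsOf-unique ⊤) s s≤down₂
  ... | g , g-inj , g-ok = cap-copy {c = c} B g g-inj λ j →
    let (g⊂B , colour) = proj₂ (g-ok j) in proj₁ g⊂B , (λ g≡B → ⊂-irref g≡B g⊂B) , colour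

  few-pairs-if-up₁<r-down₂<s : ∀ {r s} →
    All (λ A → up₁ A < r) (subsets N) → All (λ B → down₂ B < s) (subsets N) →
    3 ^ N + 2 ^ N ≤ (r + s) * 2 ^ N
  few-pairs-if-up₁<r-down₂<s {r} {s} up₁<r down₂<s = begin
    3 ^ N + 2 ^ N                                               ≡⟨ cong (_+ 2 ^ N) ∑up₁+∑down₂ ⟨
    ∑ (subsets N) up₁ + ∑ (subsets N) down₂ + 2 ^ N + 2 ^ N     ≡⟨ regroup _ _ (2 ^ N) ⟩
    (2 ^ N + ∑ (subsets N) up₁) + (2 ^ N + ∑ (subsets N) down₂) ≡⟨ cong₂ _+_ (∑-suc′ up₁) (∑-suc′ down₂) ⟨
    ∑[ A ∈ subsets N ] suc (up₁ A) + ∑[ B ∈ subsets N ] suc (down₂ B)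
      ≤⟨ +-mono-≤ (∑-bound (suc ∘ up₁) up₁<r) (∑-bound (suc ∘ down₂) down₂<s) ⟩
    2 ^ N * r + 2 ^ N * s                                       ≡⟨ *-distribˡ-+ (2 ^ N) r s ⟨
    2 ^ N * (r + s)                                             ≡⟨ *-comm (2 ^ N) (r + s) ⟩
    (r + s) * 2 ^ N                                             ∎
    where
    open ≤-Reasoning
    regroup : ∀ u d p → u + d + p + p ≡ (p + u) + (p + d)
    regroup = solve-∀
    ∑-suc′ : ∀ f → ∑[ A ∈ subsets N ] suc (f A) ≡ 2 ^ N + ∑ (subsets N) f
    ∑-suc′ f = trans (∑-suc (subsets N) f) (cong (_+ ∑ (subsets N) f) (length-subsets N))
    ∑-bound : ∀ {k} f → All (λ A → f A ≤ k) (subsets N) → ∑ (subsets N) f ≤ 2 ^ N * k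
    ∑-bound f f≤k = subst (λ l → ∑ (subsets N) f ≤ l * _) (length-subsets N) (∑-≤ f f≤k)

  cup-or-cap-or-few-pairs : ∀ r s →
    Copy N c (Cup r) colour₁ ⊎ Copy N c (Cap s) colour₂ ⊎ 3 ^ N + 2 ^ N ≤ (r + s) * 2 ^ N
  cup-or-cap-or-few-pairs r s with Any.any? (λ A → r ≤? up₁ A) (subsets N)
  ... | yes cup = inj₁ (cup-if-r≤up₁ _ (proj₂ (Any.satisfied cup)))
  ... | no ¬cup with Any.any? (λ B → s ≤? down₂ B) (subsets N)
  ...   | yes cap = inj₂ (inj₁ (cap-if-s≤down₂ _ (proj₂ (Any.satisfied cap))))
  ...   | no ¬cap = inj₂ (inj₂ (few-pairs-if-up₁<r-down₂<s (below up₁ ¬cup) (below down₂ ¬cap)))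
    where
    below : ∀ {k} f → ¬ Any.Any (λ A → k ≤ f A) (subsets N) → All (λ A → f A < k) (subsets N)
    below f ¬any = All.map ≰⇒> (¬Any⇒All¬ (subsets N) ¬any)

3^n-odd : ∀ n → ∃[ k ] 3 ^ n ≡ suc (2 * k)
3^n-odd zero    = 0 , refl
3^n-odd (suc n) with 3^n-odd n
... | k , 3^n≡2k+1 = 3 * k + 1 , trans (cong (3 *_) 3^n≡2k+1) (regroup k)
  where
  regroup : ∀ k → 3 * suc (2 * k) ≡ suc (2 * (3 * k + 1))
  regroup = solve-∀

3^n≢m*2^n : ∀ n {m} → 2 ≤ m → 3 ^ n ≢ m * 2 ^ n
3^n≢m*2^n zero    (s≤s (s≤s _)) ()
3^n≢m*2^n (suc n) {m} _ 3^n≡ with 3^n-odd (suc n)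
... | k , 3^n≡2k+1 = even≢odd (m * 2 ^ n) k (begin
  2 * (m * 2 ^ n) ≡⟨ *-comm 2 (m * 2 ^ n) ⟩
  m * 2 ^ n * 2   ≡⟨ *-assoc m (2 ^ n) 2 ⟩
  m * (2 ^ n * 2) ≡⟨ cong (m *_) (*-comm (2 ^ n) 2) ⟩
  m * 2 ^ suc n   ≡⟨ 3^n≡ ⟨
  3 ^ suc n       ≡⟨ 3^n≡2k+1 ⟩
  suc (2 * k)     ∎)
  where open ≡-Reasoning

arrows-if-[r+s∸1]*2^N≤3^N : ∀ {N r s} → 3 ≤ r + s → (r + s ∸ 1) * 2 ^ N ≤ 3 ^ N →
  Arrows N (Cup r) (Cap s)
arrows-if-[r+s∸1]*2^N≤3^N {N} {r} {s} 3≤r+s bound c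
  with ColourCounts.cup-or-cap-or-few-pairs c r s
... | inj₁ cup        = inj₁ cup
... | inj₂ (inj₁ cap) = inj₂ cap
... | inj₂ (inj₂ few) = contradiction (≤-antisym 3^N≤m*2^N bound) (3^n≢m*2^n N (∸-monoˡ-≤ 1 3≤r+s))
  where
  m = r + s ∸ 1
  3^N≤m*2^N : 3 ^ N ≤ m * 2 ^ N
  3^N≤m*2^N = +-cancelʳ-≤ (2 ^ N) (3 ^ N) (m * 2 ^ N) (begin
    3 ^ N + 2 ^ N         ≤⟨ few ⟩
    (r + s) * 2 ^ N       ≡⟨ cong (_* 2 ^ N) (m+[n∸m]≡n (≤-trans (s≤s z≤n) 3≤r+s)) ⟨
    (1 + m) * 2 ^ N       ≡⟨ +-comm (2 ^ N) (m * 2 ^ N) ⟩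
    m * 2 ^ N + 2 ^ N     ∎)
    where open ≤-Reasoning

injective-into⇒≤length : ∀ {A : Set} {m} {xs : List A} (g : Fin m → A) →
  Injective _≡_ _≡_ g → (∀ i → g i ∈ xs) → m ≤ length xs
injective-into⇒≤length {xs = xs} g g-inj g∈xs = injective⇒≤ {f = Any.index ∘ g∈xs} λ {i} {j} same-index →
  g-inj (trans (lookup-index (g∈xs i)) (trans (cong (lookup xs) same-index) (sym (lookup-index (g∈xs j)))))

∣∁p∣+∣p∣≡n : ∀ {n} (p : Subset n) → ∣ ∁ p ∣ + ∣ p ∣ ≡ n
∣∁p∣+∣p∣≡n p = trans (cong (_+ ∣ p ∣) (∣∁p∣≡n∸∣p∣ p)) (m∸n+n≡m (∣p∣≤n p))

∣∁p∣≡0⇒p≡⊤ : ∀ {n} (p : Subset n) → ∣ ∁ p ∣ ≡ 0 → p ≡ ⊤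
∣∁p∣≡0⇒p≡⊤ p ∣∁p∣≡0 = ∣p∣≡n⇒p≡⊤ (≤-antisym (∣p∣≤n p) (m∸n≡0⇒m≤n (trans (sym (∣∁p∣≡n∸∣p∣ p)) ∣∁p∣≡0)))

nearlyFull : ∀ n → List (Subset n)
nearlyFull zero    = [ [] ]
nearlyFull (suc n) = (outside ∷ ⊤) ∷ map (inside ∷_) (nearlyFull n)

length-nearlyFull : ∀ n → length (nearlyFull n) ≡ suc n
length-nearlyFull zero    = refl
length-nearlyFull (suc n) = cong suc (trans (length-map (inside ∷_) (nearlyFull n)) (length-nearlyFull n))

∈-nearlyFull : ∀ {n} (p : Subset n) → ∣ ∁ p ∣ ≤ 1 → p ∈ nearlyFull n
∈-nearlyFull []            _            = here refl
∈-nearlyFull (outside ∷ p) (s≤s ∣∁p∣≤0) = here (cong (outside ∷_) (∣∁p∣≡0⇒p≡⊤ p (n≤0⇒n≡0 ∣∁p∣≤0)))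
∈-nearlyFull (inside ∷ p)  ∣∁p∣≤1       = there (∈-map⁺ (inside ∷_) (∈-nearlyFull p ∣∁p∣≤1))

0≢suc : ∀ {n} {i : Fin n} → Fin.zero ≢ suc i
0≢suc ()

colourBy : ∀ {P : Set} → Dec P → Colour
colourBy (yes _) = colour₂
colourBy (no _)  = colour₁

colourBy-colour₂ : ∀ {P : Set} (P? : Dec P) → colourBy P? ≡ colour₂ → P
colourBy-colour₂ (yes p) _ = p

colourBy-colour₁ : ∀ {P : Set} (P? : Dec P) → colourBy P? ≡ colour₁ → ¬ P
colourBy-colour₁ (no ¬p) _ = ¬p

thresholdColouring : ∀ N → ℕ → Colouring N
thresholdColouring N k A B = colourBy (k ≤? ∣ ∁ B ∣)

cap-in-thresholdColouring : ∀ {N k s} → Copy N (thresholdColouring N k) (Cap (suc s)) colour₂ →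
  2 ^ k * suc (suc s) ≤ 2 ^ N
cap-in-thresholdColouring {N} {k} {s} (f , f-inj , f-mono , f-edge) = begin
  2 ^ k * suc (suc s)    ≤⟨ *-monoʳ-≤ (2 ^ k) s+2≤2^∣B∣ ⟩
  2 ^ k * 2 ^ ∣ B ∣       ≡⟨ ^-distribˡ-+-* 2 k ∣ B ∣ ⟨
  2 ^ (k + ∣ B ∣)         ≤⟨ ^-monoʳ-≤ 2 k+∣B∣≤N ⟩
  2 ^ N                  ∎
  where
  open ≤-Reasoning
  B = f zero
  k+∣B∣≤N : k + ∣ B ∣ ≤ N
  k+∣B∣≤N = subst (k + ∣ B ∣ ≤_) (∣∁p∣+∣p∣≡n B)
    (+-monoˡ-≤ ∣ B ∣ (colourBy-colour₂ (k ≤? ∣ ∁ B ∣) (f-edge (suc zero) zero cap-edge)))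
  f⊆B : ∀ v → f v ⊆ B
  f⊆B zero    = ⊆-refl
  f⊆B (suc i) = f-mono (suc i) zero cap-xy
  s+2≤2^∣B∣ : suc (suc s) ≤ 2 ^ ∣ B ∣
  s+2≤2^∣B∣ = subst (suc (suc s) ≤_) (length-subsetsOf B)
    (injective-into⇒≤length f f-inj (∈-subsetsOf ∘ f⊆B))

cup-tops-in-thresholdColouring : ∀ {N k r} → Copy N (thresholdColouring N k) (Cup r) colour₁ →
  Σ (Fin r → Subset N) λ g → Injective _≡_ _≡_ g × (∀ i → ∣ ∁ (g i) ∣ < k)
cup-tops-in-thresholdColouring {N} {k} (f , f-inj , _ , f-edge) =
  f ∘ suc , Fin-suc-injective ∘ f-inj , λ i →
    ≰⇒> (colourBy-colour₁ (k ≤? ∣ ∁ (f (suc i)) ∣) (f-edge zero (suc i) cup-edge))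

no-cup-in-thresholdColouring₁ : ∀ {N r} → ¬ Copy N (thresholdColouring N 1) (Cup (2 + r)) colour₁
no-cup-in-thresholdColouring₁ cup with cup-tops-in-thresholdColouring cup
... | g , g-inj , ∣∁g∣<1 = 0≢suc (g-inj (trans (full zero) (sym (full (suc zero)))))
  where
  full : ∀ i → g i ≡ ⊤
  full i = ∣∁p∣≡0⇒p≡⊤ (g i) (n<1⇒n≡0 (∣∁g∣<1 i))

cup-in-thresholdColouring₂ : ∀ {N r} → Copy N (thresholdColouring N 2) (Cup r) colour₁ → r ≤ suc N
cup-in-thresholdColouring₂ {N} cup with cup-tops-in-thresholdColouring cup
... | g , g-inj , ∣∁g∣<2 = subst (_ ≤_) (length-nearlyFull N)
  (injective-into⇒≤length g g-inj λ i → ∈-nearlyFull (g i) (≤-pred (∣∁g∣<2 i)))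

Avoids : ℕ → ℕ → ℕ → Set
Avoids N r s = ∃[ c ] (¬ Copy N c (Cup r) colour₁ × ¬ Copy N c (Cap s) colour₂)

avoids⇒¬arrows : ∀ {N r s} → Avoids N r s → ¬ Arrows N (Cup r) (Cap s)
avoids⇒¬arrows (c , no-cup , no-cap) arrows = [ no-cup , no-cap ]′ (arrows c)

∁-injective : ∀ {n} {p q : Subset n} → ∁ p ≡ ∁ q → p ≡ q
∁-injective {p = p} {q} ∁p≡∁q = trans (sym (∁-involutive p)) (trans (cong ∁ ∁p≡∁q) (∁-involutive q))
  where
  ∁-involutive : ∀ p → ∁ (∁ p) ≡ p
  ∁-involutive p = trans (sym (map-∘ not not p)) (trans (map-cong not-involutive p) (map-id p))

swapColour : Colour → Colour
swapColour colour₁ = colour₂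
swapColour colour₂ = colour₁

swapColour-≡ : ∀ {x i} → swapColour x ≡ i → x ≡ swapColour i
swapColour-≡ {colour₁} refl = refl
swapColour-≡ {colour₂} refl = refl

dualColouring : ∀ {N} → Colouring N → Colouring N
dualColouring c A B = swapColour (c (∁ B) (∁ A))

module _ {N} {c : Colouring N} where

  cup-in-dual⇒cap : ∀ {r} → Copy N (dualColouring c) (Cup r) colour₁ → Copy N c (Cap r) colour₂
  cup-in-dual⇒cap (f , f-inj , f-mono , f-edge) =
    cap-copy {c = c} (∁ (f zero)) (∁ ∘ f ∘ suc) (Fin-suc-injective ∘ f-inj ∘ ∁-injective) λ j →
      p⊆q⇒∁p⊇∁q (f-mono zero (suc j) cup-xy) ,
      (λ ∁-equal → 0≢suc (f-inj (∁-injective (sym ∁-equal)))) ,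
      swapColour-≡ (f-edge zero (suc j) cup-edge)

  cap-in-dual⇒cup : ∀ {s} → Copy N (dualColouring c) (Cap s) colour₂ → Copy N c (Cup s) colour₁
  cap-in-dual⇒cup (f , f-inj , f-mono , f-edge) =
    cup-copy {c = c} (∁ (f zero)) (∁ ∘ f ∘ suc) (Fin-suc-injective ∘ f-inj ∘ ∁-injective) λ j →
      p⊆q⇒∁p⊇∁q (f-mono (suc j) zero cap-xy) ,
      (λ ∁-equal → 0≢suc (f-inj (∁-injective ∁-equal))) ,
      swapColour-≡ (f-edge (suc j) zero cap-edge)

avoids-swap : ∀ {N r s} → Avoids N r s → Avoids N s r
avoids-swap (c , no-cup , no-cap) =
  dualColouring c , no-cap ∘ cup-in-dual⇒cap {c = c} , no-cup ∘ cap-in-dual⇒cup {c = c}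

data ThresholdAvoidable (N r s : ℕ) : Set where
  by-threshold₁ : 2 ^ N < 2 * suc s → ThresholdAvoidable N r s
  by-threshold₂ : 2 + N ≤ r → 2 ^ N < 4 * suc s → ThresholdAvoidable N r s

avoids-if-thresholdAvoidable : ∀ {N r s} → 2 ≤ r → ThresholdAvoidable N r (suc s) → Avoids N r (suc s)
avoids-if-thresholdAvoidable {N} (s≤s (s≤s _)) (by-threshold₁ 2^N<2[s+1]) =
  thresholdColouring N 1 , no-cup-in-thresholdColouring₁ , λ cap → <⇒≱ 2^N<2[s+1] (cap-in-thresholdColouring cap)
avoids-if-thresholdAvoidable {N} _ (by-threshold₂ N+2≤r 2^N<4[s+1]) =
  thresholdColouring N 2 ,
  (λ cup → <⇒≱ N+2≤r (cup-in-thresholdColouring₂ cup)) ,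
  (λ cap → <⇒≱ 2^N<4[s+1] (cap-in-thresholdColouring cap))

thresholdAvoidable? : ∀ N r s → Dec (ThresholdAvoidable N r s)
thresholdAvoidable? N r s = map′ from-⊎ to-⊎ ((2 ^ N <? 2 * suc s) ⊎-dec ((2 + N ≤? r) ×-dec (2 ^ N <? 4 * suc s)))
  where
  from-⊎ : 2 ^ N < 2 * suc s ⊎ (2 + N ≤ r × 2 ^ N < 4 * suc s) → ThresholdAvoidable N r s
  from-⊎ (inj₁ few)          = by-threshold₁ few
  from-⊎ (inj₂ (long , few)) = by-threshold₂ long few
  to-⊎ : ThresholdAvoidable N r s → 2 ^ N < 2 * suc s ⊎ (2 + N ≤ r × 2 ^ N < 4 * suc s)
  to-⊎ (by-threshold₁ few)      = inj₁ few
  to-⊎ (by-threshold₂ long few) = inj₂ (long , few)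

pronic≤2ab⇒<a+b : ∀ {a b t} → 1 ≤ a → t * suc t ≤ 2 * (a * b) → t < a + b
pronic≤2ab⇒<a+b {a} {b} {t} 1≤a t-bound = ≰⇒> λ a+b≤t → <-irrefl refl (begin-strict
  2 * (a * b)                   ≤⟨ m≤m+n (2 * (a * b)) (a * a + b * b) ⟩
  2 * (a * b) + (a * a + b * b) ≡⟨ square a b ⟩
  (a + b) * (a + b)             <⟨ m<n+m ((a + b) * (a + b)) (≤-trans 1≤a (m≤m+n a b)) ⟩
  (a + b) + (a + b) * (a + b)   ≡⟨ *-suc (a + b) (a + b) ⟨
  (a + b) * suc (a + b)         ≤⟨ *-mono-≤ a+b≤t (s≤s a+b≤t) ⟩
  t * suc t                     ≤⟨ t-bound ⟩
  2 * (a * b)                   ∎)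
  where
  open ≤-Reasoning
  square : ∀ a b → 2 * (a * b) + (a * a + b * b) ≡ (a + b) * (a + b)
  square = solve-∀

sum≤P-if-both-large : ∀ {P a b t} → t < a + b → 4 * suc (suc a) ≤ P → 4 * suc (suc b) ≤ P →
  t + suc a + suc b ≤ P
sum≤P-if-both-large {P} {a} {b} {t} t<a+b a-bound b-bound = *-cancelˡ-≤ 2 (begin
  2 * (t + suc a + suc b)               ≤⟨ *-monoʳ-≤ 2 (+-monoˡ-≤ (suc b) (+-monoˡ-≤ (suc a) (<⇒≤ t<a+b))) ⟩
  2 * (a + b + suc a + suc b)           ≤⟨ m≤m+n _ 12 ⟩
  2 * (a + b + suc a + suc b) + 12      ≡⟨ regroup a b ⟩
  4 * suc (suc a) + 4 * suc (suc b)     ≤⟨ +-mono-≤ a-bound b-bound ⟩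
  P + P                                 ≡⟨ cong (P +_) (+-identityʳ P) ⟨
  2 * P                                 ∎)
  where
  open ≤-Reasoning
  regroup : ∀ a b → 2 * (a + b + suc a + suc b) + 12 ≡ 4 * suc (suc a) + 4 * suc (suc b)
  regroup = solve-∀

-- A larger sum would force t ≥ 7W + 1, hence t (t + 1) > 16 W² ≥ a · 2 (b + 2) > 2ab.
sum≤16W-if-a≤W : ∀ {W a b t} → a ≤ W → 2 * suc (suc b) ≤ 16 * W → t * suc t ≤ 2 * (a * b) →
  t + suc a + suc b ≤ 16 * W
sum≤16W-if-a≤W {W} {a} {b} {t} a≤W b-bound t-bound = ≮⇒≥ λ 16W<sum → <-irrefl refl (begin-strict
  W * (16 * W)                                   <⟨ m<m+n (W * (16 * W)) z<s ⟩
  W * (16 * W) + suc (33 * (W * W) + 21 * W + 1) ≡⟨ expand W ⟩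
  (7 * W + 1) * suc (7 * W + 1)                  ≤⟨ *-mono-≤ (t-large 16W<sum) (s≤s (t-large 16W<sum)) ⟩
  t * suc t                                      ≤⟨ t-bound ⟩
  2 * (a * b)                                    ≤⟨ m≤m+n (2 * (a * b)) (4 * a) ⟩
  2 * (a * b) + 4 * a                            ≡⟨ factor a b ⟩
  a * (2 * suc (suc b))                          ≤⟨ *-mono-≤ a≤W b-bound ⟩
  W * (16 * W)                                   ∎)
  where
  open ≤-Reasoning
  expand : ∀ W → W * (16 * W) + suc (33 * (W * W) + 21 * W + 1) ≡ (7 * W + 1) * suc (7 * W + 1)
  expand = solve-∀
  factor : ∀ a b → 2 * (a * b) + 4 * a ≡ a * (2 * suc (suc b))
  factor = solve-∀
  K = 18 * W + 2 * a + 2 * b + 4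
  t-large : 16 * W < t + suc a + suc b → 7 * W + 1 ≤ t
  t-large 16W<sum = *-cancelˡ-≤ 2 (+-cancelʳ-≤ K (2 * (7 * W + 1)) (2 * t) (begin
    2 * (7 * W + 1) + K                           ≡⟨ lhs W a b ⟩
    2 * suc (16 * W) + 2 * suc (suc b) + 2 * a
      ≤⟨ +-mono-≤ (+-mono-≤ (*-monoʳ-≤ 2 16W<sum) b-bound) (*-monoʳ-≤ 2 a≤W) ⟩
    2 * (t + suc a + suc b) + 16 * W + 2 * W      ≡⟨ rhs W a b t ⟩
    2 * t + K                                     ∎))
    where
    lhs : ∀ W a b → 2 * (7 * W + 1) + (18 * W + 2 * a + 2 * b + 4) ≡ 2 * suc (16 * W) + 2 * suc (suc b) + 2 * a
    lhs = solve-∀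
    rhs : ∀ W a b t → 2 * (t + suc a + suc b) + 16 * W + 2 * W ≡ 2 * t + (18 * W + 2 * a + 2 * b + 4)
    rhs = solve-∀

-- The smallest t with 2^N < t + a + b + 2 is 2^N ∸ (a + b + 1); for N < 7 the hypotheses
-- force a, b ≤ 30, so finitely many cases remain.
SmallCase : ℕ → ℕ → ℕ → Set
SmallCase N a b = ¬ ThresholdAvoidable N (suc a) (suc b) → ¬ ThresholdAvoidable N (suc b) (suc a) →
  2 * (a * b) < (2 ^ N ∸ (a + b + 1)) * suc (2 ^ N ∸ (a + b + 1))

smallCase? : ∀ N a b → Dec (SmallCase N a b)
smallCase? N a b =
  ¬? (thresholdAvoidable? N (suc a) (suc b)) →-dec ¬? (thresholdAvoidable? N (suc b) (suc a)) →-dec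
  2 * (a * b) <? (2 ^ N ∸ (a + b + 1)) * suc (2 ^ N ∸ (a + b + 1))

smallCase-table : ∀ (N : Fin 7) (a b : Fin 31) → SmallCase (toℕ N) (toℕ a) (toℕ b)
smallCase-table = toWitness {a? = all? λ N → all? λ a → all? λ b → smallCase? (toℕ N) (toℕ a) (toℕ b)} tt

smallCase : ∀ {N a b} → N < 7 → a < 31 → b < 31 → SmallCase N a b
smallCase {N} {a} {b} N<7 a<31 b<31 =
  subst (λ N → SmallCase N a b) (toℕ-fromℕ< N<7) (
  subst (λ a → SmallCase _ a b) (toℕ-fromℕ< a<31) (
  subst (SmallCase _ _) (toℕ-fromℕ< b<31)
  (smallCase-table (fromℕ< N<7) (fromℕ< a<31) (fromℕ< b<31))))

7+k≤2^[3+k] : ∀ k → 7 + k ≤ 2 ^ (3 + k)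
7+k≤2^[3+k] zero    = s≤s (s≤s (s≤s (s≤s (s≤s (s≤s (s≤s z≤n))))))
7+k≤2^[3+k] (suc k) = begin
  1 + (7 + k)               ≤⟨ +-monoˡ-≤ (7 + k) (s≤s (z≤n {6 + k})) ⟩
  (7 + k) + (7 + k)         ≤⟨ +-mono-≤ (7+k≤2^[3+k] k) (7+k≤2^[3+k] k) ⟩
  2 ^ (3 + k) + 2 ^ (3 + k) ≡⟨ cong (2 ^ (3 + k) +_) (+-identityʳ (2 ^ (3 + k))) ⟨
  2 ^ (4 + k)               ∎
  where open ≤-Reasoning

module _ {N r s : ℕ} (¬ta : ¬ ThresholdAvoidable N r s) where

  ¬thresholdAvoidable⇒2[s+1]≤2^N : 2 * suc s ≤ 2 ^ N
  ¬thresholdAvoidable⇒2[s+1]≤2^N = ≮⇒≥ (λ 2^N<2[s+1] → ¬ta (by-threshold₁ 2^N<2[s+1]))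

  ¬thresholdAvoidable⇒4[s+1]≤2^N : 2 + N ≤ r → 4 * suc s ≤ 2 ^ N
  ¬thresholdAvoidable⇒4[s+1]≤2^N N+2≤r = ≮⇒≥ (λ 2^N<4[s+1] → ¬ta (by-threshold₂ N+2≤r 2^N<4[s+1]))

sum≤2^N-if-small-N : ∀ {N a b t} → N < 7 → t * suc t ≤ 2 * (a * b) →
  ¬ ThresholdAvoidable N (suc a) (suc b) → ¬ ThresholdAvoidable N (suc b) (suc a) → t + suc a + suc b ≤ 2 ^ N
sum≤2^N-if-small-N {N} {a} {b} {t} N<7 t-bound ¬ta ¬ta′ = ≮⇒≥ λ 2^N<sum →
  <⇒≱ (smallCase N<7 (<31 ¬ta′) (<31 ¬ta) ¬ta ¬ta′) (≤-trans (*-mono-≤ (m≤t 2^N<sum) (s≤s (m≤t 2^N<sum))) t-bound)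
  where
  <31 : ∀ {r x} → ¬ ThresholdAvoidable N r (suc x) → x < 31
  <31 ¬ta = ≤-pred (*-cancelˡ-≤ 2 (≤-trans (¬thresholdAvoidable⇒2[s+1]≤2^N ¬ta) (^-monoʳ-≤ 2 (≤-pred N<7))))
  m≤t : 2 ^ N < t + suc a + suc b → 2 ^ N ∸ (a + b + 1) ≤ t
  m≤t 2^N<sum = m≤n+o⇒m∸n≤o (2 ^ N) (a + b + 1) (≤-pred (subst (2 ^ N <_) (regroup t a b) 2^N<sum))
    where
    regroup : ∀ t a b → t + suc a + suc b ≡ suc (a + b + 1 + t)
    regroup = solve-∀

sum≤2^[7+k]-if-a≤7+k : ∀ {k a b t} → a ≤ 7 + k → 2 * suc (suc b) ≤ 2 ^ (7 + k) →
  t * suc t ≤ 2 * (a * b) → t + suc a + suc b ≤ 2 ^ (7 + k)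
sum≤2^[7+k]-if-a≤7+k {k} a≤N b-bound t-bound = ≤-trans
  (sum≤16W-if-a≤W (≤-trans a≤N (7+k≤2^[3+k] k)) (≤-trans b-bound (≤-reflexive 2^[7+k]≡16W)) t-bound)
  (≤-reflexive (sym 2^[7+k]≡16W))
  where
  2^[7+k]≡16W : 2 ^ (7 + k) ≡ 16 * 2 ^ (3 + k)
  2^[7+k]≡16W = ^-distribˡ-+-* 2 4 (3 + k)

sum≤2^N-if-large-N : ∀ {k a b t} → 1 ≤ a → t * suc t ≤ 2 * (a * b) →
  ¬ ThresholdAvoidable (7 + k) (suc a) (suc b) → ¬ ThresholdAvoidable (7 + k) (suc b) (suc a) →
  t + suc a + suc b ≤ 2 ^ (7 + k)
sum≤2^N-if-large-N {k} {a} {b} {t} 1≤a t-bound ¬ta ¬ta′ with a ≤? 7 + k | b ≤? 7 + k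
... | yes a≤N | _ = sum≤2^[7+k]-if-a≤7+k a≤N (¬thresholdAvoidable⇒2[s+1]≤2^N ¬ta) t-bound
... | no _ | yes b≤N = subst (_≤ 2 ^ (7 + k)) (xy∙z≈xz∙y t (suc b) (suc a))
  (sum≤2^[7+k]-if-a≤7+k b≤N (¬thresholdAvoidable⇒2[s+1]≤2^N ¬ta′)
    (subst (t * suc t ≤_) (cong (2 *_) (*-comm a b)) t-bound))
... | no a≰N | no b≰N = sum≤P-if-both-large (pronic≤2ab⇒<a+b 1≤a t-bound)
  (¬thresholdAvoidable⇒4[s+1]≤2^N ¬ta′ (s≤s (≰⇒> b≰N)))
  (¬thresholdAvoidable⇒4[s+1]≤2^N ¬ta (s≤s (≰⇒> a≰N)))

sum≤2^N-if-neither : ∀ {N a b t} → 1 ≤ a → t * suc t ≤ 2 * (a * b) →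
  ¬ ThresholdAvoidable N (suc a) (suc b) → ¬ ThresholdAvoidable N (suc b) (suc a) → t + suc a + suc b ≤ 2 ^ N
sum≤2^N-if-neither {N} 1≤a t-bound ¬ta ¬ta′ with N <? 7
... | yes N<7 = sum≤2^N-if-small-N N<7 t-bound ¬ta ¬ta′
... | no N≮7 with m≤n⇒∃[o]m+o≡n (≮⇒≥ N≮7)
...   | k , refl = sum≤2^N-if-large-N 1≤a t-bound ¬ta ¬ta′

thresholdAvoidable-either : ∀ {N a b t} → 1 ≤ a → t * suc t ≤ 2 * (a * b) → 2 ^ N < t + suc a + suc b →
  ThresholdAvoidable N (suc a) (suc b) ⊎ ThresholdAvoidable N (suc b) (suc a)
thresholdAvoidable-either {N} {a} {b} 1≤a t-bound 2^N<sum
  with thresholdAvoidable? N (suc a) (suc b) | thresholdAvoidable? N (suc b) (suc a)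
... | yes ta | _       = inj₁ ta
... | no _   | yes ta′ = inj₂ ta′
... | no ¬ta | no ¬ta′ = contradiction (sum≤2^N-if-neither 1≤a t-bound ¬ta ¬ta′) (<⇒≱ 2^N<sum)

-- With t = ⌊(q − 1)/2⌋ we have 2t + 1 ≤ q and (2t + 1)² = 1 + 4 t (t + 1).
pronic-bound-of-square≤ : ∀ m q → q * q ≤ 1 + 8 * m → (q ∸ 1) / 2 * suc ((q ∸ 1) / 2) ≤ 2 * m
pronic-bound-of-square≤ m zero    _     = z≤n
pronic-bound-of-square≤ m (suc q) q²≤ = *-cancelˡ-≤ 4 (+-cancelˡ-≤ 1 _ _ (subst₂ _≤_ (odd-square t) (regroup m)
  (≤-trans (*-mono-≤ 2t+1≤q+1 2t+1≤q+1) q²≤)))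
  where
  t = q / 2
  2t+1≤q+1 : suc (t * 2) ≤ suc q
  2t+1≤q+1 = s≤s (m/n*n≤m q 2)
  odd-square : ∀ t → suc (t * 2) * suc (t * 2) ≡ 1 + 4 * (t * suc t)
  odd-square = solve-∀
  regroup : ∀ m → 1 + 8 * m ≡ 1 + 4 * (2 * m)
  regroup = solve-∀

arrows⇒sum≤2^N : ∀ {N a b t} → 1 ≤ a → 1 ≤ b → t * suc t ≤ 2 * (a * b) →
  Arrows N (Cup (suc a)) (Cap (suc b)) → t + suc a + suc b ≤ 2 ^ N
arrows⇒sum≤2^N {N} {a} {b} {t} 1≤a 1≤b t-bound arrows with t + suc a + suc b ≤? 2 ^ N
... | yes sum≤2^N = sum≤2^N
... | no  sum≰2^N = contradiction arrows (avoids⇒¬arrows avoids)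
  where
  avoids : Avoids N (suc a) (suc b)
  avoids with thresholdAvoidable-either 1≤a t-bound (≰⇒> sum≰2^N)
  ... | inj₁ ta  = avoids-if-thresholdAvoidable (s≤s 1≤a) ta
  ... | inj₂ ta′ = avoids-swap (avoids-if-thresholdAvoidable (s≤s 1≤b) ta′)

theorem3p7 : ∀ (r s : ℕ) → 2 ≤ r → 2 ≤ s →
    (∀ q → IsFloorSqrt (1 + 8 * ((r ∸ 1) * (s ∸ 1))) q →
      ∀ N → Arrows N (Cup r) (Cap s) → (q ∸ 1) / 2 + r + s ≤ 2 ^ N)
    × (∀ k → IsCeilLog32 (r + s ∸ 1) k →
      ∃[ N ] (N ≤ k × Arrows N (Cup r) (Cap s)))
theorem3p7 (suc a) (suc b) (s≤s 1≤a) (s≤s 1≤b) =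
  (λ q (q²≤ , _) N arrows → arrows⇒sum≤2^N 1≤a 1≤b (pronic-bound-of-square≤ (a * b) q q²≤) arrows) ,
  (λ k ([r+s∸1]*2^k≤3^k , _) → k , ≤-refl , arrows-if-[r+s∸1]*2^N≤3^N 3≤r+s [r+s∸1]*2^k≤3^k)
  where
  3≤r+s : 3 ≤ suc a + suc b
  3≤r+s = s≤s (+-mono-≤ 1≤a (s≤s z≤n))
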